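{- Let $\Sigma$ be a finite totally ordered alphabet and let $\prec$ denote $V$-order on $\Sigma^*$. For any two strings $\mathbf{x},\mathbf{y}\in\Sigma^*$ and any letter $\lambda\in\Sigma$, $$\mathbf{x}\prec\mathbf{y}\iff \mathbf{x}\lambda\prec\mathbf{y}\lambda.$$
   Context: $\Sigma^*$ denotes the set of all finite strings over $\Sigma$, including the empty string $\varepsilon$. For a nonempty string $\mathbf{x}=x_1x_2\cdots x_n$, define $h\in\{1,\ldots,n\}$ by $h=1$ if $x_1\le x_2\le\cdots\le x_n$, and otherwise as the unique index with $x_{h-1}>x_h\le x_{h+1}\le\cdots\le x_n$; let $\mathbf{x}^*$ be the string obtained from $\mathbf{x}$ by deleting the letter $x_h$. Write $\mathbf{x}^{s*}$ for the result of applying $^*$ $s$ times ($\mathbf{x}^{0*}=\mathbf{x}$); the sequence $\mathbf{x},\mathbf{x}^*,\mathbf{x}^{2*},\ldots$ ends with $\varepsilon$. $V$-order $\prec$ is defined for distinct strings $\mathbf{x},\mathbf{y}$ as follows: $\mathbf{x}\prec\mathbf{y}$ if $\mathbf{x}$ occurs in the sequence $\mathbf{y},\mathbf{y}^*,\mathbf{y}^{2*},\ldots,\varepsilon$. If neither string occurs in the other's sequence, there are smallest $s,t\ge 0$ with $\mathbf{x}^{(s+1)*}=\mathbf{y}^{(t+1)*}$; put $\mathbf{s}=\mathbf{x}^{s*}$, $\mathbf{t}=\mathbf{y}^{t*}$, which are distinct strings of equal length $m$; let $j\in\{1,\ldots,m\}$ be the largest index with $\mathbf{s}[j]\ne\mathbf{t}[j]$;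 then $\mathbf{x}\prec\mathbf{y}$ iff $\mathbf{s}[j]<\mathbf{t}[j]$ in $\Sigma$. This is a strict total order on $\Sigma^*$. -}

module Defs where

open import Data.Nat using (ℕ; zero; suc; _≤_)
open import Data.Fin using (Fin)
import Data.Fin as F
open import Data.Fin.Properties using (_≤?_)
open import Data.List using (List; []; _∷_; _++_; length)
open import Data.List.Relation.Unary.Linked using (Linked; linked?)
open import Data.Product using (Σ; ∃; ∃-syntax; _×_)
open import Data.Sum using (_⊎_)
open import Relation.Nullary using (¬_; yes; no)
open import Relation.Binary.PropositionalEquality using (_≡_; _≢_)

-- The alphabet Σ is Fin n (a finite totally ordered set, usual order on Fin).
module _ {n : ℕ} where

  Str : Set
  Str = List (Fin n)

  NonDecreasing : Str → Set
  NonDecreasing = Linked F._≤_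

  -- x* : delete the letter x_h, where h is the start of the maximal
  -- non-decreasing suffix (h = 1 if the whole string is non-decreasing).
  star : Str → Str
  star [] = []
  star (a ∷ xs) with linked? _≤?_ (a ∷ xs)
  ... | yes _ = xs
  ... | no  _ = a ∷ star xs

  iter : ℕ → Str → Str
  iter zero    x = x
  iter (suc s) x = star (iter s x)

  InSeq : Str → Str → Set
  InSeq x y = ∃[ k ] iter k y ≡ x

  MinMeet : Str → Str → ℕ → ℕ → Set
  MinMeet x y s t =
    iter (suc s) x ≡ iter (suc t) y ×
    (∀ s' t' → iter (suc s') x ≡ iter (suc t') y → s ≤ s' × t ≤ t')

  -- for distinct strings u, v of equal length: at the largest index j with
  -- u[j] ≠ v[j] we have u[j] < v[j]  (i.e. u = p a w, v = q b w, |p| = |q|, a < b)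
  LastDiffLess : Str → Str → Set
  LastDiffLess u v =
    Σ Str λ p → Σ Str λ q → Σ Str λ w → Σ (Fin n) λ a → Σ (Fin n) λ b →
      u ≡ p ++ a ∷ w × v ≡ q ++ b ∷ w × length p ≡ length q × a F.< b

  infix 4 _≺_
  _≺_ : Str → Str → Set
  x ≺ y = x ≢ y ×
    (InSeq x y ⊎
     (¬ InSeq x y × ¬ InSeq y x ×
      ∃[ s ] ∃[ t ] (MinMeet x y s t × LastDiffLess (iter s x) (iter t y))))

-- Dropping the minimality clauses of V-order (the last-difference condition already forces
-- them), x ≺ y says: x lies in the sequence y, y*, y²*, …, or some u in the sequence of x and
-- some v in that of y satisfy u* = v* with u below v at their last difference.
-- Appending λ changes these sequences in a controlled way: while the current term c ends in a
-- letter ≤ λ, (cλ)* = c*λ, so the sequence of xλ follows that of x with λ appended; at the first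
-- term c that is empty or ends above λ, (cλ)* = c, and from there on it is the sequence of x.
-- Hence the branch points for xλ and yλ are those for x and y, with or without λ appended,
-- except when only one side is already absorbed there; the comparison then moves to the
-- absorption step, between λ and a larger letter, and the absorbed side is the larger one.
module Submission where

open import Defs
open import Data.Nat using (ℕ; zero; suc; _+_; _∸_; pred; _≤_; _<_; s≤s⁻¹)
open import Data.Fin using (Fin)
open import Data.List using (List; []; _∷_; _++_)
open import Function.Bundles using (_⇔_)

import Data.Nat.Properties as ℕ
import Data.Fin as F
import Data.Fin.Properties as F
open import Data.Fin.Properties using (_≤?_)
open import Data.List using (_∷ʳ_; length; last)
open import Data.List.Properties
  using (++-assoc; length-++; ∷-injective; ∷ʳ-injectiveˡ; ∷ʳ-injectiveʳ; ++-conicalʳ)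
open import Data.List.Reverse using (reverseView; []; _∶_∶ʳ_)
open import Data.List.Relation.Unary.Linked using (Linked; linked?; []; [-]; _∷_)
open import Data.Maybe using (just; nothing)
open import Data.Maybe.Relation.Unary.All using (All; just; nothing; drop-just)
open import Data.Maybe.Relation.Unary.Any using (Any; just)
open import Data.Product using (_×_; _,_; proj₁; proj₂)
open import Data.Sum using (_⊎_; inj₁; inj₂)
open import Data.Empty using (⊥-elim)
open import Function using (_∘_; mk⇔)
open import Relation.Binary.Core using (Rel)
open import Relation.Nullary using (¬_; yes; no)
open import Relation.Binary.PropositionalEquality
open ≡-Reasoning

module _ {a ℓ} {A : Set a} {R : Rel A ℓ} where

  Linked-++⁻ˡ : ∀ xs {ys} → Linked R (xs ++ ys) → Linked R xs
  Linked-++⁻ˡ []           _         = []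
  Linked-++⁻ˡ (_ ∷ [])     _         = [-]
  Linked-++⁻ˡ (_ ∷ y ∷ xs) (r ∷ rs)  = r ∷ Linked-++⁻ˡ (y ∷ xs) rs

module _ {a} {A : Set a} where

  ++-cancelˡ-length : ∀ (p q : List A) {xs ys} →
                      length p ≡ length q → p ++ xs ≡ q ++ ys → xs ≡ ys
  ++-cancelˡ-length []      []      _  eq = eq
  ++-cancelˡ-length (_ ∷ p) (_ ∷ q) lq eq =
    ++-cancelˡ-length p q (ℕ.suc-injective lq) (proj₂ (∷-injective eq))

  length-∷ʳ : ∀ (xs : List A) x → length (xs ∷ʳ x) ≡ suc (length xs)
  length-∷ʳ []       x = refl
  length-∷ʳ (_ ∷ xs) x = cong suc (length-∷ʳ xs x)

  last-∷ʳ : ∀ (xs : List A) x → last (xs ∷ʳ x) ≡ just x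
  last-∷ʳ []           x = refl
  last-∷ʳ (_ ∷ [])     x = refl
  last-∷ʳ (_ ∷ y ∷ xs) x = last-∷ʳ (y ∷ xs) x

  last-++-∷ : ∀ (p : List A) x w → last (p ++ x ∷ w) ≡ last (x ∷ w)
  last-++-∷ []           x w = refl
  last-++-∷ (_ ∷ [])     x w = refl
  last-++-∷ (_ ∷ y ∷ p)  x w = last-++-∷ (y ∷ p) x w

∸-cancelˡ-≢0 : ∀ m {i j} → m ∸ i ≡ m ∸ j → m ∸ i ≢ 0 → i ≡ j
∸-cancelˡ-≢0 m {i} {j} eq m∸i≢0 =
  ℕ.≤-antisym (ℕ.∸-cancelʳ-≤ (ℕ.<⇒≤ i<m) (ℕ.≤-reflexive (sym eq)))
              (ℕ.∸-cancelʳ-≤ (ℕ.<⇒≤ j<m) (ℕ.≤-reflexive eq))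
  where
  i<m = ℕ.m∸n≢0⇒n<m m∸i≢0
  j<m = ℕ.m∸n≢0⇒n<m (m∸i≢0 ∘ trans eq)

module _ {n : ℕ} where

  private
    variable
      x y u v w b c : Str {n}
      e : Fin n

  length-star : ∀ (xs : Str {n}) → length (star xs) ≡ pred (length xs)
  length-star []       = refl
  length-star (a ∷ xs) with linked? _≤?_ (a ∷ xs)
  ... | yes _ = refl
  ... | no ¬lk with xs
  ...   | []     = ⊥-elim (¬lk [-])
  ...   | y ∷ ys = cong suc (length-star (y ∷ ys))

  iter-suc : ∀ k (y : Str {n}) → iter (suc k) y ≡ iter k (star y)
  iter-suc zero    y = refl
  iter-suc (suc k) y = cong star (iter-suc k y)

  iter-+ : ∀ i j (y : Str {n}) → iter (i + j) y ≡ iter i (iter j y)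
  iter-+ zero    j y = refl
  iter-+ (suc i) j y = cong star (iter-+ i j y)

  length-iter : ∀ k (y : Str {n}) → length (iter k y) ≡ length y ∸ k
  length-iter zero    y = refl
  length-iter (suc k) y = begin
    length (star (iter k y))   ≡⟨ length-star (iter k y) ⟩
    pred (length (iter k y))   ≡⟨ cong pred (length-iter k y) ⟩
    pred (length y ∸ k)        ≡⟨ ℕ.pred[m∸n]≡m∸[1+n] (length y) k ⟩
    length y ∸ suc k           ∎

  length-iter-injective : ∀ {i j} (y : Str {n}) → length (iter i y) ≡ length (iter j y) →
                          length (iter i y) ≢ 0 → i ≡ j
  length-iter-injective {i} {j} y eq ≢0 =
    ∸-cancelˡ-≢0 (length y) (trans (sym (length-iter i y)) (trans eq (length-iter j y)))
                            (≢0 ∘ trans (length-iter i y))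

  InSeq-refl : InSeq y y
  InSeq-refl = 0 , refl

  star-InSeq : InSeq (star y) y
  star-InSeq = 1 , refl

  InSeq-trans : InSeq u v → InSeq v w → InSeq u w
  InSeq-trans {w = w} (i , refl) (j , refl) = i + j , iter-+ i j w

  -- Meeting earlier would make the sequences agree from then on, and a non-empty term of a
  -- sequence is determined by its length.
  meet-after : ∀ {s t i j} → length (iter s x) ≡ length (iter t y) → length (iter s x) ≢ 0 →
               iter s x ≢ iter t y → iter i x ≡ iter j y → s < i
  meet-after {x} {y} {s} {t} {i} {j} |≡| ≢0 u≢v meet = ℕ.≰⇒> i≰s
    where
    i≰s : ¬ i ≤ s
    i≰s i≤s = u≢v (trans u≡ (cong (λ k → iter k y) k≡t))
      where
      u≡ : iter s x ≡ iter (s ∸ i + j) y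
      u≡ = begin
        iter s x                 ≡⟨ cong (λ k → iter k x) (sym (ℕ.m∸n+n≡m i≤s)) ⟩
        iter (s ∸ i + i) x       ≡⟨ iter-+ (s ∸ i) i x ⟩
        iter (s ∸ i) (iter i x)  ≡⟨ cong (iter (s ∸ i)) meet ⟩
        iter (s ∸ i) (iter j y)  ≡⟨ iter-+ (s ∸ i) j y ⟨
        iter (s ∸ i + j) y       ∎
      k≡t : s ∸ i + j ≡ t
      k≡t = length-iter-injective y (trans (cong length (sym u≡)) |≡|)
                                    (≢0 ∘ trans (cong length u≡))

  LastDiffLess-∷ʳ⁺ : LastDiffLess u v → LastDiffLess (u ∷ʳ e) (v ∷ʳ e)
  LastDiffLess-∷ʳ⁺ {e = e} (p , q , w , a , b , refl , refl , lp , a<b) =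
    p , q , w ∷ʳ e , a , b , ++-assoc p (a ∷ w) _ , ++-assoc q (b ∷ w) _ , lp , a<b

  LastDiffLess-∷ʳ⁻ : LastDiffLess (u ∷ʳ e) (v ∷ʳ e) → LastDiffLess u v
  LastDiffLess-∷ʳ⁻ {u} {e} {v} (p , q , w , a , b , eu , ev , lp , a<b) with reverseView w
  ... | [] = ⊥-elim (F.<-irrefl (trans (sym (∷ʳ-injectiveʳ u p eu)) (∷ʳ-injectiveʳ v q ev)) a<b)
  ... | w′ ∶ _ ∶ʳ d =
    p , q , w′ , a , b , unsnoc u p a eu , unsnoc v q b ev , lp , a<b
    where
    unsnoc : ∀ z r f → z ∷ʳ e ≡ r ++ f ∷ (w′ ∷ʳ d) → z ≡ r ++ f ∷ w′
    unsnoc z r f eq = ∷ʳ-injectiveˡ z (r ++ f ∷ w′) (trans eq (sym (++-assoc r (f ∷ w′) _)))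

  LastDiffLess⇒≢ : LastDiffLess u v → u ≢ v
  LastDiffLess⇒≢ (p , q , w , a , b , refl , refl , lp , a<b) eq =
    F.<-irrefl (proj₁ (∷-injective (++-cancelˡ-length p q lp eq))) a<b

  LastDiffLess⇒length≡ : LastDiffLess u v → length u ≡ length v
  LastDiffLess⇒length≡ (p , q , w , a , b , refl , refl , lp , _) =
    trans (length-++ p) (trans (cong (_+ suc (length w)) lp) (sym (length-++ q)))

  LastDiffLess⇒length≢0 : LastDiffLess u v → length u ≢ 0
  LastDiffLess⇒length≢0 (p , q , w , a , b , refl , refl , _ , _) =
    ℕ.m+1+n≢0 (length p) ∘ trans (sym (length-++ p))

  LastDiffLess⇒≢[]ʳ : LastDiffLess u v → v ≢ []
  LastDiffLess⇒≢[]ʳ (p , q , w , a , b , _ , refl , _ , _) eq with ++-conicalʳ q (b ∷ w) eq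
  ... | ()

  data Fork (x y : Str {n}) : Set where
    fork : InSeq u x → InSeq v y → star u ≡ star v → LastDiffLess u v → Fork x y

  infix 4 _≺′_
  _≺′_ : Str {n} → Str {n} → Set
  x ≺′ y = x ≢ y × (InSeq x y ⊎ Fork x y)

  ≺⇒≺′ : x ≺ y → x ≺′ y
  ≺⇒≺′ (x≢y , inj₁ x∈y) = x≢y , inj₁ x∈y
  ≺⇒≺′ (x≢y , inj₂ (_ , _ , s , t , (meet , _) , less)) =
    x≢y , inj₂ (fork (s , refl) (t , refl) meet less)

  ≺′⇒≺ : x ≺′ y → x ≺ y
  ≺′⇒≺ (x≢y , inj₁ x∈y) = x≢y , inj₁ x∈y
  ≺′⇒≺ {x} {y} (x≢y , inj₂ (fork (s , refl) (t , refl) meet less)) =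
    x≢y , inj₂ (x∉y , y∉x , s , t , (meet , minimal) , less)
    where
    |≡| = LastDiffLess⇒length≡ less
    ≢0  = LastDiffLess⇒length≢0 less
    u≢v = LastDiffLess⇒≢ less

    after-s : ∀ {i j} → iter i x ≡ iter j y → s < i
    after-s {i} {j} = meet-after {x} {y} {s} {t} {i} {j} |≡| ≢0 u≢v

    after-t : ∀ {i j} → iter i x ≡ iter j y → t < j
    after-t {i} {j} =
      meet-after {y} {x} {t} {s} {j} {i} (sym |≡|) (≢0 ∘ trans |≡|) (u≢v ∘ sym) ∘ sym

    x∉y : ¬ InSeq x y
    x∉y (k , eq) with after-s {0} {k} (sym eq)
    ... | ()

    y∉x : ¬ InSeq y x
    y∉x (k , eq) with after-t {k} {0} eq
    ... | ()

    minimal : ∀ s′ t′ → iter (suc s′) x ≡ iter (suc t′) y → s ≤ s′ × t ≤ t′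
    minimal s′ t′ eq = s≤s⁻¹ (after-s {suc s′} {suc t′} eq) ,
                       s≤s⁻¹ (after-t {suc s′} {suc t′} eq)

  module _ (l : Fin n) where

    EndsAbove : Str {n} → Set
    EndsAbove y = All (l F.<_) (last y)

    EndsAtMost : Str {n} → Set
    EndsAtMost y = Any (F._≤ l) (last y)

    ending : ∀ y → EndsAbove y ⊎ EndsAtMost y
    ending y with last y
    ... | nothing = inj₁ nothing
    ... | just e with l F.<? e
    ...   | yes l<e = inj₁ (just l<e)
    ...   | no  l≮e = inj₂ (just (ℕ.≮⇒≥ l≮e))

    EndsAbove⇒¬EndsAtMost : ∀ y → EndsAbove y → ¬ EndsAtMost y
    EndsAbove⇒¬EndsAtMost y with last y
    ... | just e = λ { (just l<e) (just e≤l) → ℕ.<⇒≱ l<e e≤l }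
    ... | nothing = λ { _ () }

    EndsAtMost-∷ʳ : ∀ y → EndsAtMost (y ∷ʳ l)
    EndsAtMost-∷ʳ y = subst (Any (F._≤ l)) (sym (last-∷ʳ y l)) (just F.≤-refl)

    ¬EndsAbove-∷ʳ : ∀ y → ¬ EndsAbove (y ∷ʳ l)
    ¬EndsAbove-∷ʳ y ea = EndsAbove⇒¬EndsAtMost (y ∷ʳ l) ea (EndsAtMost-∷ʳ y)

    ¬Linked-∷ʳ-above : ∀ a ys → EndsAbove (a ∷ ys) → ¬ Linked F._≤_ (a ∷ ys ∷ʳ l)
    ¬Linked-∷ʳ-above a []       (just l<a) (a≤l ∷ _) = ℕ.<⇒≱ l<a a≤l
    ¬Linked-∷ʳ-above a (b ∷ ys) ea         (_ ∷ lk)  = ¬Linked-∷ʳ-above b ys ea lk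

    Linked-∷ʳ-atMost : ∀ ys → EndsAtMost ys → Linked F._≤_ ys → Linked F._≤_ (ys ∷ʳ l)
    Linked-∷ʳ-atMost (a ∷ [])     (just a≤l) _        = a≤l ∷ [-]
    Linked-∷ʳ-atMost (a ∷ b ∷ ys) eam        (r ∷ lk) = r ∷ Linked-∷ʳ-atMost (b ∷ ys) eam lk

    star-∷ʳ-above : ∀ y → EndsAbove y → star (y ∷ʳ l) ≡ y
    star-∷ʳ-above []       _  = refl
    star-∷ʳ-above (a ∷ ys) ea with linked? _≤?_ (a ∷ ys ∷ʳ l)
    ... | yes lk = ⊥-elim (¬Linked-∷ʳ-above a ys ea lk)
    ... | no  _ with ys
    ...   | []     = refl
    ...   | b ∷ zs = cong (a ∷_) (star-∷ʳ-above (b ∷ zs) ea)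

    star-∷ʳ-atMost : ∀ y → EndsAtMost y → star (y ∷ʳ l) ≡ star y ∷ʳ l
    star-∷ʳ-atMost (a ∷ ys) eam with linked? _≤?_ (a ∷ ys) | linked? _≤?_ (a ∷ ys ∷ʳ l)
    ... | yes _  | yes _   = refl
    ... | yes lk | no ¬lk  = ⊥-elim (¬lk (Linked-∷ʳ-atMost (a ∷ ys) eam lk))
    ... | no ¬lk | yes lk  = ⊥-elim (¬lk (Linked-++⁻ˡ (a ∷ ys) lk))
    ... | no ¬lk | no _ with ys
    ...   | []     = ⊥-elim (¬lk [-])
    ...   | b ∷ zs = cong (a ∷_) (star-∷ʳ-atMost (b ∷ zs) eam)

    star∷ʳ-InSeq : ∀ c → EndsAtMost c → InSeq (star c ∷ʳ l) (c ∷ʳ l)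
    star∷ʳ-InSeq c eam = subst (λ z → InSeq z (c ∷ʳ l)) (star-∷ʳ-atMost c eam) star-InSeq

    EndsAbove-star : ∀ y → EndsAbove y → EndsAbove (star y)
    EndsAbove-star []       _  = nothing
    EndsAbove-star (a ∷ ys) ea with linked? _≤?_ (a ∷ ys)
    ... | yes _ with ys
    ...   | []    = nothing
    ...   | _ ∷ _ = ea
    EndsAbove-star (a ∷ ys) ea | no ¬lk with ys
    ... | []               = ⊥-elim (¬lk [-])
    ... | b ∷ []           = just (F.<-trans (drop-just ea) (ℕ.≰⇒> (¬lk ∘ (_∷ [-]))))
    -- star (b ∷ zs) is non-empty by its length, so prefixing a keeps its last letter
    ... | b ∷ zs@(_ ∷ _) with star (b ∷ zs) | length-star (b ∷ zs) | EndsAbove-star (b ∷ zs) ea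
    ...   | _ ∷ _ | _ | ea′ = ea′

    EndsAbove-iter : ∀ k y → EndsAbove y → EndsAbove (iter k y)
    EndsAbove-iter zero    y ea = ea
    EndsAbove-iter (suc k) y ea = EndsAbove-star (iter k y) (EndsAbove-iter k y ea)

    InSeq-∷ʳ-above : InSeq b y → EndsAbove b → InSeq b (y ∷ʳ l)
    InSeq-∷ʳ-above {b} (k , eq) ea = go k eq
      where
      go : ∀ k {y} → iter k y ≡ b → InSeq b (y ∷ʳ l)
      go zero    refl = 1 , star-∷ʳ-above _ ea
      go (suc k) {y} eq with ending y
      ... | inj₁ eaʸ  = InSeq-trans (suc k , eq) (1 , star-∷ʳ-above y eaʸ)
      ... | inj₂ eamʸ = InSeq-trans (go k (trans (sym (iter-suc k y)) eq)) (star∷ʳ-InSeq y eamʸ)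

    InSeq-∷ʳ-atMost : InSeq c y → EndsAtMost c → InSeq (c ∷ʳ l) (y ∷ʳ l)
    InSeq-∷ʳ-atMost {c} (k , eq) eam = go k eq
      where
      go : ∀ k {y} → iter k y ≡ c → InSeq (c ∷ʳ l) (y ∷ʳ l)
      go zero    refl = InSeq-refl
      go (suc k) {y} eq with ending y
      ... | inj₁ eaʸ  = ⊥-elim (EndsAbove⇒¬EndsAtMost c eaᶜ eam)
        where eaᶜ = subst EndsAbove eq (EndsAbove-iter (suc k) y eaʸ)
      ... | inj₂ eamʸ = InSeq-trans (go k (trans (sym (iter-suc k y)) eq)) (star∷ʳ-InSeq y eamʸ)

    EndsAtMost-∷ʳ⁻ : ∀ p {a} → EndsAtMost (p ∷ʳ a) → a F.≤ l
    EndsAtMost-∷ʳ⁻ p {a} eam with subst (Any (F._≤ l)) (last-∷ʳ p a) eam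
    ... | just a≤l = a≤l

    EndsAbove-∷ʳ⁻ : ∀ q {b} → EndsAbove (q ∷ʳ b) → l F.< b
    EndsAbove-∷ʳ⁻ q {b} ea with subst (All (l F.<_)) (last-∷ʳ q b) ea
    ... | just l<b = l<b

    LastDiffLess-EndsAbove : LastDiffLess u v → EndsAbove u → EndsAbove v
    LastDiffLess-EndsAbove (p , q , w , a , b , refl , refl , _ , a<b) ea =
      subst (All (l F.<_)) (sym (last-++-∷ q b w))
            (shift w (subst (All (l F.<_)) (last-++-∷ p a w) ea))
      where
      shift : ∀ w → All (l F.<_) (last (a ∷ w)) → All (l F.<_) (last (b ∷ w))
      shift []      (just l<a) = just (F.<-trans l<a a<b)
      shift (_ ∷ _) ea         = ea

    LastDiffLess-atMost-above : star u ≡ star v → EndsAtMost u → EndsAbove v → v ≢ [] →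
                                LastDiffLess u v
    LastDiffLess-atMost-above {u} {v} meet eam ea v≢[] with reverseView u | reverseView v
    ... | []          | _           = ⊥-elim (case-nothing eam)
      where
      case-nothing : ¬ Any (F._≤ l) nothing
      case-nothing ()
    ... | _ ∶ _ ∶ʳ _  | []          = ⊥-elim (v≢[] refl)
    ... | p ∶ _ ∶ʳ a  | q ∶ _ ∶ʳ b  =
      p , q , [] , a , b , refl , refl , lp ,
      ℕ.≤-<-trans (EndsAtMost-∷ʳ⁻ p eam) (EndsAbove-∷ʳ⁻ q ea)
      where
      lp : length p ≡ length q
      lp = begin
        length p                  ≡⟨ cong pred (length-∷ʳ p a) ⟨
        pred (length (p ∷ʳ a))    ≡⟨ length-star (p ∷ʳ a) ⟨
        length (star (p ∷ʳ a))    ≡⟨ cong length meet ⟩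
        length (star (q ∷ʳ b))    ≡⟨ length-star (q ∷ʳ b) ⟩
        pred (length (q ∷ʳ b))    ≡⟨ cong pred (length-∷ʳ q b) ⟩
        length q                  ∎

    star-∷ʳ≡-above : ∀ b → EndsAbove w → star (b ∷ʳ l) ≡ w → b ≡ w
    star-∷ʳ≡-above b ea eq with ending b
    ... | inj₁ eaᵇ  = trans (sym (star-∷ʳ-above b eaᵇ)) eq
    ... | inj₂ eamᵇ = ⊥-elim (¬EndsAbove-∷ʳ (star b) (subst EndsAbove (sym eq′) ea))
      where eq′ = trans (sym (star-∷ʳ-atMost b eamᵇ)) eq

    star-∷ʳ-cancel : ∀ b b′ → star (b ∷ʳ l) ≡ star (b′ ∷ʳ l) → b ≢ b′ → star b ≡ star b′
    star-∷ʳ-cancel b b′ eq b≢b′ with ending b | ending b′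
    ... | inj₁ ea  | _        =
      ⊥-elim (b≢b′ (sym (star-∷ʳ≡-above b′ ea (trans (sym eq) (star-∷ʳ-above b ea)))))
    ... | _        | inj₁ ea′ =
      ⊥-elim (b≢b′ (star-∷ʳ≡-above b ea′ (trans eq (star-∷ʳ-above b′ ea′))))
    ... | inj₂ eam | inj₂ eam′ = ∷ʳ-injectiveˡ (star b) (star b′) (begin
      star b ∷ʳ l     ≡⟨ star-∷ʳ-atMost b eam ⟨
      star (b ∷ʳ l)   ≡⟨ eq ⟩
      star (b′ ∷ʳ l)  ≡⟨ star-∷ʳ-atMost b′ eam′ ⟩
      star b′ ∷ʳ l    ∎)

    -- The sequence of y ∷ʳ l runs through b ∷ʳ l for the Kept b: y, then star c for the
    -- successive terms c of the sequence of y ending at most l; from the first term ending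
    -- above l on, it is the sequence of y itself.
    data Kept (y : Str {n}) : Str {n} → Set where
      start : Kept y y
      next  : InSeq c y → EndsAtMost c → Kept y (star c)

    data InSeq-∷ʳ-View (y a : Str {n}) : Set where
      kept     : Kept y b → a ≡ b ∷ʳ l → InSeq-∷ʳ-View y a
      absorbed : InSeq a y → EndsAbove a → InSeq-∷ʳ-View y a

    Kept⇒InSeq : Kept y b → InSeq b y
    Kept⇒InSeq start          = InSeq-refl
    Kept⇒InSeq (next c∈y _)   = InSeq-trans star-InSeq c∈y

    inSeq-∷ʳ-view : ∀ {a} → InSeq a (y ∷ʳ l) → InSeq-∷ʳ-View y a
    inSeq-∷ʳ-view {a = a} (k , eq) = go k eq
      where
      go : ∀ k {y} → iter k (y ∷ʳ l) ≡ a → InSeq-∷ʳ-View y a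
      go zero    eq = kept start (sym eq)
      go (suc k) {y} eq with ending y
      ... | inj₁ ea = absorbed (k , eq′) (subst EndsAbove eq′ (EndsAbove-iter k y ea))
        where
        eq′ : iter k y ≡ a
        eq′ = trans (cong (iter k) (sym (star-∷ʳ-above y ea)))
                    (trans (sym (iter-suc k (y ∷ʳ l))) eq)
      ... | inj₂ eam = from-star (go k eq′)
        where
        eq′ : iter k (star y ∷ʳ l) ≡ a
        eq′ = trans (cong (iter k) (sym (star-∷ʳ-atMost y eam)))
                    (trans (sym (iter-suc k (y ∷ʳ l))) eq)
        from-star : InSeq-∷ʳ-View (star y) a → InSeq-∷ʳ-View y a
        from-star (kept start e)           = kept (next InSeq-refl eam) e
        from-star (kept (next c∈ eamᶜ) e)  = kept (next (InSeq-trans c∈ star-InSeq) eamᶜ) e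
        from-star (absorbed a∈ eaᵃ)        = absorbed (InSeq-trans a∈ star-InSeq) eaᵃ

    fork-at-absorbed : InSeq (star v ∷ʳ l) x → InSeq v y → EndsAbove v → v ≢ [] → Fork x (y ∷ʳ l)
    fork-at-absorbed {v} p v∈y ea v≢[] =
      fork p (InSeq-∷ʳ-above v∈y ea) meet
           (LastDiffLess-atMost-above meet (EndsAtMost-∷ʳ (star v)) ea v≢[])
      where meet = star-∷ʳ-above (star v) (EndsAbove-star v ea)

    InSeq-∷ʳ⁺ : ∀ j → iter j y ≡ x → x ≢ y → InSeq (x ∷ʳ l) (y ∷ʳ l) ⊎ Fork (x ∷ʳ l) (y ∷ʳ l)
    InSeq-∷ʳ⁺ zero    refl x≢y = ⊥-elim (x≢y refl)
    InSeq-∷ʳ⁺ {y = y} (suc j) refl x≢y with ending (iter j y)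
    ... | inj₂ eam =
      inj₁ (InSeq-trans (star∷ʳ-InSeq (iter j y) eam) (InSeq-∷ʳ-atMost (j , refl) eam))
    ... | inj₁ ea with iter j y in c≡
    ...   | []    = InSeq-∷ʳ⁺ j c≡ x≢y
    ...   | _ ∷ _ = inj₂ (fork-at-absorbed InSeq-refl (j , c≡) ea (λ ()))

    Fork-∷ʳ⁺ : Fork x y → Fork (x ∷ʳ l) (y ∷ʳ l)
    Fork-∷ʳ⁺ (fork {u} {v} u∈ v∈ meet less) with ending u | ending v
    ... | inj₁ eaᵘ  | inj₁ eaᵛ  = fork (InSeq-∷ʳ-above u∈ eaᵘ) (InSeq-∷ʳ-above v∈ eaᵛ) meet less
    ... | inj₁ eaᵘ  | inj₂ eamᵛ =
      ⊥-elim (EndsAbove⇒¬EndsAtMost v (LastDiffLess-EndsAbove less eaᵘ) eamᵛ)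
    ... | inj₂ eamᵘ | inj₁ eaᵛ  = fork-at-absorbed sv∈ v∈ eaᵛ (LastDiffLess⇒≢[]ʳ less)
      where
      sv∈ = InSeq-trans (subst (λ z → InSeq (z ∷ʳ l) (u ∷ʳ l)) meet (star∷ʳ-InSeq u eamᵘ))
                        (InSeq-∷ʳ-atMost u∈ eamᵘ)
    ... | inj₂ eamᵘ | inj₂ eamᵛ =
      fork (InSeq-∷ʳ-atMost u∈ eamᵘ) (InSeq-∷ʳ-atMost v∈ eamᵛ) meet′ (LastDiffLess-∷ʳ⁺ less)
      where
      meet′ = begin
        star (u ∷ʳ l)  ≡⟨ star-∷ʳ-atMost u eamᵘ ⟩
        star u ∷ʳ l    ≡⟨ cong (_∷ʳ l) meet ⟩
        star v ∷ʳ l    ≡⟨ star-∷ʳ-atMost v eamᵛ ⟨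
        star (v ∷ʳ l)  ∎

    InSeq-∷ʳ⁻ : InSeq (x ∷ʳ l) (y ∷ʳ l) → InSeq x y
    InSeq-∷ʳ⁻ {x} {y} x∈ with inSeq-∷ʳ-view x∈
    ... | kept {b} kb eq  = subst (λ z → InSeq z y) (sym (∷ʳ-injectiveˡ x b eq)) (Kept⇒InSeq kb)
    ... | absorbed _ ea   = ⊥-elim (¬EndsAbove-∷ʳ x ea)

    Kept-meets-absorbed : Kept x b → b ≡ star v → InSeq v y → EndsAbove v → v ≢ [] →
                          InSeq x y ⊎ Fork x y
    Kept-meets-absorbed start          refl v∈ _  _    = inj₁ (InSeq-trans star-InSeq v∈)
    Kept-meets-absorbed (next c∈ eamᶜ) meet v∈ ea v≢[] =
      inj₂ (fork c∈ v∈ meet (LastDiffLess-atMost-above meet eamᶜ ea v≢[]))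

    Fork-∷ʳ⁻ : Fork (x ∷ʳ l) (y ∷ʳ l) → InSeq x y ⊎ Fork x y
    Fork-∷ʳ⁻ (fork {u} {v} u∈ v∈ meet less) with inSeq-∷ʳ-view u∈ | inSeq-∷ʳ-view v∈
    ... | absorbed u∈x _ | absorbed v∈y _ = inj₂ (fork u∈x v∈y meet less)
    ... | absorbed _ eaᵘ | kept {b′} _ refl =
      ⊥-elim (¬EndsAbove-∷ʳ b′ (LastDiffLess-EndsAbove less eaᵘ))
    ... | kept {b} kb refl | absorbed v∈y eaᵛ =
      Kept-meets-absorbed kb (star-∷ʳ≡-above b (EndsAbove-star v eaᵛ) meet) v∈y eaᵛ
                          (LastDiffLess⇒≢[]ʳ less)
    ... | kept {b} kb refl | kept {b′} kb′ refl =
      inj₂ (fork (Kept⇒InSeq kb) (Kept⇒InSeq kb′)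
                 (star-∷ʳ-cancel b b′ meet (LastDiffLess⇒≢ less ∘ cong (_∷ʳ l)))
                 (LastDiffLess-∷ʳ⁻ less))

    ≺′-∷ʳ⁺ : x ≺′ y → x ∷ʳ l ≺′ y ∷ʳ l
    ≺′-∷ʳ⁺ {x} {y} (x≢y , inj₁ (j , x∈y)) = x≢y ∘ ∷ʳ-injectiveˡ x y , InSeq-∷ʳ⁺ j x∈y x≢y
    ≺′-∷ʳ⁺ {x} {y} (x≢y , inj₂ f)         = x≢y ∘ ∷ʳ-injectiveˡ x y , inj₂ (Fork-∷ʳ⁺ f)

    ≺′-∷ʳ⁻ : x ∷ʳ l ≺′ y ∷ʳ l → x ≺′ y
    ≺′-∷ʳ⁻ (x≢y , inj₁ x∈y) = x≢y ∘ cong (_∷ʳ l) , inj₁ (InSeq-∷ʳ⁻ x∈y)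
    ≺′-∷ʳ⁻ (x≢y , inj₂ f)   = x≢y ∘ cong (_∷ʳ l) , Fork-∷ʳ⁻ f

lemma3 : (n : ℕ) (x y : List (Fin n)) (l : Fin n) →
         (x ≺ y) ⇔ ((x ++ l ∷ []) ≺ (y ++ l ∷ []))
lemma3 n x y l = mk⇔ (≺′⇒≺ ∘ ≺′-∷ʳ⁺ l ∘ ≺⇒≺′) (≺′⇒≺ ∘ ≺′-∷ʳ⁻ l ∘ ≺⇒≺′)
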